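{- Let $k \geq 3$ be an integer. For each $i \in [2^k]$, choose vectors $a_i, v_i^1, \ldots, v_i^{2k} \in \mathbb{F}_2^{7k}$ uniformly at random and independently (independently over all $i$ as well), and let $V_i = \langle v_i^1, \ldots, v_i^{2k}\rangle$ (the linear span) and $A_i = V_i + a_i$. Then with probability at least $1 - 2^{ -k+2}$, all of the following hold simultaneously: (a) for all $i$, $\dim(V_i) = 2k$; (b) for all $i \neq j$, $A_i \cap A_j = \emptyset$; (c) for all $i \neq j$, $V_i \cap V_j = \{0\}$; (d) for every nonzero $v \in \mathbb{F}_2^{7k}$, $|\{i \in [2^k] : v \in V_i^{\perp}\}| \leq 7$.
   Context: For a subspace $V \subseteq \mathbb{F}_2^{7k}$, $V^{\perp} = \{w \in \mathbb{F}_2^{7k} : \langle w, v\rangle = 0 \text{ for all } v \in V\}$, where $\langle w, v \rangle = \sum_t w_t v_t \bmod 2$. -}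

module Defs where

open import Data.Bool using (Bool; true; false; _xor_; _∧_)
open import Data.Nat using (ℕ; zero; suc; _*_; _^_; _≤_; _+_)
open import Data.Fin using (Fin) renaming (zero to fzero; suc to fsuc)
open import Data.Vec using (Vec; []; _∷_; zipWith; replicate; foldr; lookup; map)
open import Data.Product using (Σ; ∃; _×_; _,_; proj₁; proj₂)
open import Data.List using (List; length)
open import Data.List.Relation.Unary.All using (All)
open import Data.List.Relation.Unary.Unique.Propositional using (Unique)
open import Relation.Binary.PropositionalEquality using (_≡_; _≢_)
open import Relation.Nullary using (¬_)

-- 𝔽₂ is Bool (xor = addition, ∧ = multiplication); 𝔽₂ⁿ = Vec Bool n
F2^ : ℕ → Set
F2^ n = Vec Bool n

0v : ∀ {n} → F2^ n
0v = replicate _ false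

_+v_ : ∀ {n} → F2^ n → F2^ n → F2^ n
_+v_ = zipWith _xor_

scale : ∀ {n} → Bool → F2^ n → F2^ n
scale c v = map (c ∧_) v

lincomb : ∀ {n m} → (Fin m → F2^ n) → Vec Bool m → F2^ n
lincomb {m = zero} f [] = 0v
lincomb {m = suc m} f (c ∷ cs) = scale c (f fzero) +v lincomb (λ j → f (fsuc j)) cs

SubsetF2 : ℕ → Set₁
SubsetF2 n = F2^ n → Set

Span : ∀ {n m} → (Fin m → F2^ n) → SubsetF2 n
Span f x = ∃ λ c → lincomb f c ≡ x

LinIndep : ∀ {n m} → (Fin m → F2^ n) → Set
LinIndep {m = m} f = ∀ c → lincomb f c ≡ 0v → c ≡ replicate m false

HasDim : ∀ {n} → SubsetF2 n → ℕ → Set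
HasDim {n} V d = Σ (Fin d → F2^ n) λ b →
  LinIndep b × (∀ x → (V x → Span b x) × (Span b x → V x))

Coset : ∀ {n} → SubsetF2 n → F2^ n → SubsetF2 n
Coset V a x = ∃ λ u → V u × (x ≡ u +v a)

dot : ∀ {n} → F2^ n → F2^ n → Bool
dot u v = foldr _ _xor_ false (zipWith _∧_ u v)

Perp : ∀ {n} → SubsetF2 n → SubsetF2 n
Perp V w = ∀ v → V v → dot w v ≡ false

-- A sample: for each i ∈ [2^k], the vector a_i and vectors v_i^1..v_i^{2k} in 𝔽₂^{7k}
Sample : ℕ → Set
Sample k = Vec (F2^ (7 * k) × Vec (F2^ (7 * k)) (2 * k)) (2 ^ k)

aOf : ∀ k → Sample k → Fin (2 ^ k) → F2^ (7 * k)
aOf k ω i = proj₁ (lookup ω i)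

VOf : ∀ k → Sample k → Fin (2 ^ k) → SubsetF2 (7 * k)
VOf k ω i = Span (lookup (proj₂ (lookup ω i)))

AOf : ∀ k → Sample k → Fin (2 ^ k) → SubsetF2 (7 * k)
AOf k ω i = Coset (VOf k ω i) (aOf k ω i)

-- total number of samples (uniform sample space): 2^(7k · (2k+1) · 2^k)
sampleCount : ℕ → ℕ
sampleCount k = 2 ^ (7 * k * (1 + 2 * k) * 2 ^ k)

Good : (k : ℕ) → Sample k → Set
Good k ω =
  (∀ i → HasDim (VOf k ω i) (2 * k)) ×
  (∀ i j → i ≢ j → ¬ (∃ λ x → AOf k ω i x × AOf k ω j x)) ×
  (∀ i j → i ≢ j → ∀ x → VOf k ω i x → VOf k ω j x → x ≡ 0v) ×
  (∀ (v : F2^ (7 * k)) → v ≢ 0v → ∀ (L : List (Fin (2 ^ k))) → Unique L →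
     All (λ i → Perp (VOf k ω i) v) L → length L ≤ 7)

{-# OPTIONS --safe #-}
module Submission where

-- The sample space is a finite Boolean group, and each way for (a)–(d) to fail is an event
-- R ω = 0 where R can be shifted by any y through a translation of ω (e.g. a vanishing
-- combination Σ c_t v_i^t with c_t₀ = 1 is shifted by adding y to v_i^t₀).  Such an event has
-- probability exactly 1 / |range R|.  A union bound over the four families — nontrivial
-- dependencies among the v_i^t (2^k · 2^2k events of probability 2^-7k), common points of
-- A_i and A_j, nonzero common points of V_i and V_j (2^2k · 2^4k events each), and nonzero
-- vectors orthogonal to eight distinct V_i (2^7k · 2^8k events of probability 2^-16k) — bounds
-- the failure probability by 4 · 2^-k.

open import Defs
open import Data.Bool using (Bool; true; false; not; _∧_; _xor_; T)
open import Data.Bool.Properties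
  using (T-not-≡; xor-comm; xor-assoc; xor-identityʳ; ∧-distribˡ-xor; ∧-zeroʳ; ∧-identityʳ
        ; xor-∧-commutativeRing)
open import Data.Bool.ListAction using (any)
open import Data.Empty using (⊥-elim)
open import Data.Fin as Fin using (Fin) renaming (zero to fzero; suc to fsuc)
open import Data.Nat using (ℕ; zero; suc; _+_; _*_; _^_; _∸_; _≤_; z≤n; s≤s; NonZero)
open import Data.Nat.Properties hiding (_≟_)
open import Data.Nat.Solver using (module +-*-Solver)
open import Data.List
  using (List; []; _∷_; [_]; _++_; map; length; take; allFin; cartesianProductWith; cartesianProduct; filterᵇ)
open import Data.List.Properties using (length-++; length-map; length-tabulate)
open import Data.List.Membership.Propositional using (_∈_)
open import Data.List.Membership.Propositional.Properties
  using (∈-cartesianProductWith⁺; ∈-cartesianProduct⁺; ∈-allFin)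
open import Data.List.Relation.Unary.Any using (here; there)
open import Data.List.Relation.Unary.All as All using (All; []; _∷_)
import Data.List.Relation.Unary.All.Properties as Allₚ
import Data.List.Relation.Unary.AllPairs as AllPairs
open import Data.List.Relation.Unary.Unique.Propositional using (Unique)
import Data.List.Relation.Unary.Unique.Propositional.Properties as Unique
open import Data.List.Relation.Unary.Unique.DecPropositional using (unique?)
open import Data.Product using (Σ; ∃; _×_; _,_; proj₁; proj₂)
import Data.Product.Properties as Product
open import Data.Sum using (_⊎_; inj₁; inj₂)
open import Data.Vec using (Vec; []; _∷_; zipWith; replicate; lookup; tabulate; _[_]≔_; toList)
import Data.Vec.Properties as Vecₚ
open import Data.Vec.Membership.Propositional.Properties using (∈-lookup; ∈-toList⁺)
open import Algebra.Bundles using (CommutativeRing)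
import Algebra.Properties.CommutativeSemigroup as CommutativeSemigroup
open import Function.Base using (_∘_; id; case_of_)
open import Function.Bundles using (Equivalence; mk⇔)
open import Level using (Level)
open import Relation.Binary.Definitions using (DecidableEquality)
open import Relation.Binary.PropositionalEquality
  using (_≡_; _≢_; refl; sym; trans; cong; cong₂; subst; module ≡-Reasoning)
open import Relation.Nullary using (yes; no; does; ¬_; ¬?; _×-dec_)
open import Relation.Nullary.Decidable using (does-⇔; dec-true; T?)
open import Relation.Unary using (Pred; Decidable)

open CommutativeSemigroup +-commutativeSemigroup using () renaming (interchange to +-interchange)
open CommutativeSemigroup (CommutativeRing.+-commutativeSemigroup xor-∧-commutativeRing)
  using () renaming (interchange to xor-interchange)

private variable
  a b c : Level
  A : Set a
  B : Set b
  C : Set c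

𝟙 : Bool → ℕ
𝟙 true = 1
𝟙 false = 0

∑ : List A → (A → ℕ) → ℕ
∑ [] f = 0
∑ (x ∷ xs) f = f x + ∑ xs f

syntax ∑ xs (λ x → e) = ∑[ x ← xs ] e

∑-cong : ∀ (xs : List A) {f g : A → ℕ} → (∀ x → f x ≡ g x) → ∑ xs f ≡ ∑ xs g
∑-cong [] f≗g = refl
∑-cong (x ∷ xs) f≗g = cong₂ _+_ (f≗g x) (∑-cong xs f≗g)

∑-mono : ∀ (xs : List A) {f g : A → ℕ} → (∀ x → f x ≤ g x) → ∑ xs f ≤ ∑ xs g
∑-mono [] f≤g = z≤n
∑-mono (x ∷ xs) f≤g = +-mono-≤ (f≤g x) (∑-mono xs f≤g)

∑-++ : ∀ (xs ys : List A) f → ∑ (xs ++ ys) f ≡ ∑ xs f + ∑ ys f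
∑-++ [] ys f = refl
∑-++ (x ∷ xs) ys f = trans (cong (f x +_) (∑-++ xs ys f)) (sym (+-assoc (f x) _ _))

∑-map : ∀ (h : A → B) xs f → ∑ (map h xs) f ≡ ∑[ x ← xs ] f (h x)
∑-map h [] f = refl
∑-map h (x ∷ xs) f = cong (f (h x) +_) (∑-map h xs f)

∑-distrib-+ : ∀ (xs : List A) f g → ∑[ x ← xs ] (f x + g x) ≡ ∑ xs f + ∑ xs g
∑-distrib-+ [] f g = refl
∑-distrib-+ (x ∷ xs) f g =
  trans (cong (f x + g x +_) (∑-distrib-+ xs f g)) (+-interchange (f x) (g x) _ _)

∑-*ʳ : ∀ (xs : List A) f c → ∑[ x ← xs ] (f x * c) ≡ ∑ xs f * c
∑-*ʳ [] f c = refl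
∑-*ʳ (x ∷ xs) f c = trans (cong (f x * c +_) (∑-*ʳ xs f c)) (sym (*-distribʳ-+ c (f x) _))

∑-const : ∀ (xs : List A) c → ∑[ _ ← xs ] c ≡ length xs * c
∑-const [] c = refl
∑-const (x ∷ xs) c = cong (c +_) (∑-const xs c)

∑-≤-length* : ∀ (xs : List A) {f} c → All (λ x → f x ≤ c) xs → ∑ xs f ≤ length xs * c
∑-≤-length* [] c [] = z≤n
∑-≤-length* (x ∷ xs) c (fx≤c ∷ f≤c) = +-mono-≤ fx≤c (∑-≤-length* xs c f≤c)

∑-comm : ∀ (xs : List A) (ys : List B) (f : A → B → ℕ) →
         ∑[ x ← xs ] ∑[ y ← ys ] f x y ≡ ∑[ y ← ys ] ∑[ x ← xs ] f x y
∑-comm [] ys f = sym (trans (∑-const ys 0) (*-zeroʳ (length ys)))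
∑-comm (x ∷ xs) ys f =
  trans (cong (∑ ys (f x) +_) (∑-comm xs ys f)) (sym (∑-distrib-+ ys (f x) _))

∑-cartesianProductWith : ∀ (h : A → B → C) xs ys f →
  ∑ (cartesianProductWith h xs ys) f ≡ ∑[ x ← xs ] ∑[ y ← ys ] f (h x y)
∑-cartesianProductWith h [] ys f = refl
∑-cartesianProductWith h (x ∷ xs) ys f = begin
  ∑ (map (h x) ys ++ cartesianProductWith h xs ys) f
    ≡⟨ ∑-++ (map (h x) ys) _ f ⟩
  ∑ (map (h x) ys) f + ∑ (cartesianProductWith h xs ys) f
    ≡⟨ cong₂ _+_ (∑-map (h x) ys f) (∑-cartesianProductWith h xs ys f) ⟩
  ∑[ y ← ys ] f (h x y) + ∑[ x′ ← xs ] ∑[ y ← ys ] f (h x′ y) ∎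
  where open ≡-Reasoning

length-cartesianProductWith : ∀ (h : A → B → C) xs ys →
  length (cartesianProductWith h xs ys) ≡ length xs * length ys
length-cartesianProductWith h [] ys = refl
length-cartesianProductWith h (x ∷ xs) ys = trans (length-++ (map (h x) ys))
  (cong₂ _+_ (length-map (h x) ys) (length-cartesianProductWith h xs ys))

module _ (_≟_ : DecidableEquality A) where

  ∑-𝟙-∉ : ∀ x {ys} → All (x ≢_) ys → ∑[ y ← ys ] 𝟙 (does (x ≟ y)) ≡ 0
  ∑-𝟙-∉ x [] = refl
  ∑-𝟙-∉ x {y ∷ _} (x≢y ∷ x∉ys) with x ≟ y
  ... | yes x≡y = ⊥-elim (x≢y x≡y)
  ... | no _ = ∑-𝟙-∉ x x∉ys

  ∑-𝟙-∈-unique : ∀ x {ys} → Unique ys → x ∈ ys → ∑[ y ← ys ] 𝟙 (does (x ≟ y)) ≡ 1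
  ∑-𝟙-∈-unique x {y ∷ _} (y∉ AllPairs.∷ _) x∈ with x ≟ y
  ... | yes refl = cong suc (∑-𝟙-∉ x y∉)
  ∑-𝟙-∈-unique x (_ AllPairs.∷ _) (here x≡y) | no x≢y = ⊥-elim (x≢y x≡y)
  ∑-𝟙-∈-unique x (_ AllPairs.∷ u) (there x∈) | no _ = ∑-𝟙-∈-unique x u x∈

𝟙-any : ∀ (p : A → Bool) xs → 𝟙 (any p xs) ≤ ∑[ x ← xs ] 𝟙 (p x)
𝟙-any p [] = z≤n
𝟙-any p (x ∷ xs) with p x
... | true = s≤s z≤n
... | false = 𝟙-any p xs

any-false : ∀ (p : A → Bool) {xs x} → any p xs ≡ false → x ∈ xs → p x ≡ false
any-false p {y ∷ _} none (here refl) with p y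
... | false = refl
any-false p {y ∷ _} none (there x∈) with p y
... | false = any-false p none x∈

length-filterᵇ-not+∑-𝟙 : ∀ (p : A → Bool) xs →
  length (filterᵇ (not ∘ p) xs) + ∑[ x ← xs ] 𝟙 (p x) ≡ length xs
length-filterᵇ-not+∑-𝟙 p [] = refl
length-filterᵇ-not+∑-𝟙 p (x ∷ xs) with p x
... | false = cong suc (length-filterᵇ-not+∑-𝟙 p xs)
... | true = trans (+-suc _ _) (cong suc (length-filterᵇ-not+∑-𝟙 p xs))

vectors : List A → (n : ℕ) → List (Vec A n)
vectors xs zero = [ [] ]
vectors xs (suc n) = cartesianProductWith _∷_ xs (vectors xs n)

length-vectors : ∀ (xs : List A) n → length (vectors xs n) ≡ length xs ^ n
length-vectors xs zero = refl
length-vectors xs (suc n) =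
  trans (length-cartesianProductWith _∷_ xs _) (cong (length xs *_) (length-vectors xs n))

∈-vectors : ∀ {xs : List A} → (∀ x → x ∈ xs) → ∀ {n} (v : Vec A n) → v ∈ vectors xs n
∈-vectors x∈xs [] = here refl
∈-vectors x∈xs (x ∷ v) = ∈-cartesianProductWith⁺ _∷_ (x∈xs x) (∈-vectors x∈xs v)

vectors-unique : ∀ {xs : List A} → Unique xs → ∀ n → Unique (vectors xs n)
vectors-unique u zero = [] AllPairs.∷ AllPairs.[]
vectors-unique u (suc n) = Unique.cartesianProductWith⁺ _∷_ ∷-injective u (vectors-unique u n)
  where
  ∷-injective : ∀ {x y : A} {v w : Vec A n} → x ∷ v ≡ y ∷ w → x ≡ y × v ≡ w
  ∷-injective refl = refl , refl

record FiniteBooleanGroup (A : Set) : Set where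
  infixl 6 _⊕_
  infix 4 _≟_
  field
    _⊕_ : A → A → A
    ε : A
    ⊕-identityˡ : ∀ a → ε ⊕ a ≡ a
    ⊕-cancelʳ : ∀ a b → a ⊕ b ⊕ b ≡ a
    _≟_ : DecidableEquality A
    elements : List A
    elements-unique : Unique elements
    ∈-elements : ∀ a → a ∈ elements
    -- Holds for any duplicate-free enumeration; a field because it is proved structurally
    -- for the groups built below.
    ∑-translate : ∀ (f : A → ℕ) c → ∑[ a ← elements ] f (a ⊕ c) ≡ ∑ elements f

  order : ℕ
  order = length elements

  instance
    order-nonZero : NonZero order
    order-nonZero with elements | ∈-elements ε
    ... | _ ∷ _ | _ = _

  isε : A → Bool
  isε a = does (a ≟ ε)

  ⊕-self : ∀ a → a ⊕ a ≡ ε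
  ⊕-self a = trans (cong (_⊕ a) (sym (⊕-identityˡ a))) (⊕-cancelʳ ε a)

  ⊕-≡-cancelʳ : ∀ {a b} c → a ⊕ c ≡ b ⊕ c → a ≡ b
  ⊕-≡-cancelʳ {a} {b} c eq = begin
    a         ≡⟨ ⊕-cancelʳ a c ⟨
    a ⊕ c ⊕ c ≡⟨ cong (_⊕ c) eq ⟩
    b ⊕ c ⊕ c ≡⟨ ⊕-cancelʳ b c ⟩
    b         ∎
    where open ≡-Reasoning

boolGroup : FiniteBooleanGroup Bool
boolGroup = record
  { _⊕_ = _xor_
  ; ε = false
  ; ⊕-identityˡ = λ _ → refl
  ; ⊕-cancelʳ = λ { false false → refl ; false true → refl ; true false → refl ; true true → refl }
  ; _≟_ = Data.Bool._≟_
  ; elements = false ∷ true ∷ []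
  ; elements-unique = ((λ ()) ∷ []) AllPairs.∷ ([] AllPairs.∷ AllPairs.[])
  ; ∈-elements = λ { false → here refl ; true → there (here refl) }
  ; ∑-translate = λ { f false → refl ; f true → swap (f true) (f false) }
  }
  where
  import Data.Bool
  swap : ∀ a b → a + (b + 0) ≡ b + (a + 0)
  swap a b rewrite +-identityʳ a | +-identityʳ b = +-comm a b

module _ (𝔸 : FiniteBooleanGroup A) where
  open FiniteBooleanGroup 𝔸

  private
    translate-vectors : ∀ n (f : Vec A n → ℕ) c →
      ∑[ v ← vectors elements n ] f (zipWith _⊕_ v c) ≡ ∑ (vectors elements n) f
    translate-vectors zero f [] = refl
    translate-vectors (suc n) f (c ∷ cs) = begin
      ∑[ v ← vectors elements (suc n) ] f (zipWith _⊕_ v (c ∷ cs))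
        ≡⟨ ∑-cartesianProductWith _∷_ elements _ _ ⟩
      ∑[ a ← elements ] ∑[ v ← vectors elements n ] f ((a ⊕ c) ∷ zipWith _⊕_ v cs)
        ≡⟨ ∑-cong elements (λ a → translate-vectors n (λ v → f ((a ⊕ c) ∷ v)) cs) ⟩
      ∑[ a ← elements ] ∑[ v ← vectors elements n ] f ((a ⊕ c) ∷ v)
        ≡⟨ ∑-translate (λ a → ∑[ v ← vectors elements n ] f (a ∷ v)) c ⟩
      ∑[ a ← elements ] ∑[ v ← vectors elements n ] f (a ∷ v)
        ≡⟨ ∑-cartesianProductWith _∷_ elements _ f ⟨
      ∑ (vectors elements (suc n)) f ∎
      where open ≡-Reasoning

    cancelʳ-vectors : ∀ {n} (v w : Vec A n) → zipWith _⊕_ (zipWith _⊕_ v w) w ≡ v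
    cancelʳ-vectors [] [] = refl
    cancelʳ-vectors (a ∷ v) (b ∷ w) = cong₂ _∷_ (⊕-cancelʳ a b) (cancelʳ-vectors v w)

  vecGroup : ∀ n → FiniteBooleanGroup (Vec A n)
  vecGroup n = record
    { _⊕_ = zipWith _⊕_
    ; ε = replicate n ε
    ; ⊕-identityˡ = Vecₚ.zipWith-identityˡ ⊕-identityˡ
    ; ⊕-cancelʳ = cancelʳ-vectors
    ; _≟_ = Vecₚ.≡-dec _≟_
    ; elements = vectors elements n
    ; elements-unique = vectors-unique elements-unique n
    ; ∈-elements = ∈-vectors ∈-elements
    ; ∑-translate = translate-vectors n
    }

module _ (𝔸 : FiniteBooleanGroup A) (𝔹 : FiniteBooleanGroup B) where
  private
    module 𝔸 = FiniteBooleanGroup 𝔸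
    module 𝔹 = FiniteBooleanGroup 𝔹

    translate-pairs : ∀ (f : A × B → ℕ) ((c , d) : A × B) →
      ∑[ p ← cartesianProduct 𝔸.elements 𝔹.elements ] f (proj₁ p 𝔸.⊕ c , proj₂ p 𝔹.⊕ d)
        ≡ ∑ (cartesianProduct 𝔸.elements 𝔹.elements) f
    translate-pairs f (c , d) = begin
      ∑[ p ← cartesianProduct 𝔸.elements 𝔹.elements ] f (proj₁ p 𝔸.⊕ c , proj₂ p 𝔹.⊕ d)
        ≡⟨ ∑-cartesianProductWith _,_ 𝔸.elements 𝔹.elements _ ⟩
      ∑[ a ← 𝔸.elements ] ∑[ b ← 𝔹.elements ] f (a 𝔸.⊕ c , b 𝔹.⊕ d)
        ≡⟨ ∑-cong 𝔸.elements (λ a → 𝔹.∑-translate (λ b → f (a 𝔸.⊕ c , b)) d) ⟩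
      ∑[ a ← 𝔸.elements ] ∑[ b ← 𝔹.elements ] f (a 𝔸.⊕ c , b)
        ≡⟨ 𝔸.∑-translate (λ a → ∑[ b ← 𝔹.elements ] f (a , b)) c ⟩
      ∑[ a ← 𝔸.elements ] ∑[ b ← 𝔹.elements ] f (a , b)
        ≡⟨ ∑-cartesianProductWith _,_ 𝔸.elements 𝔹.elements f ⟨
      ∑ (cartesianProduct 𝔸.elements 𝔹.elements) f ∎
      where open ≡-Reasoning

  productGroup : FiniteBooleanGroup (A × B)
  productGroup = record
    { _⊕_ = λ (a , b) (c , d) → a 𝔸.⊕ c , b 𝔹.⊕ d
    ; ε = 𝔸.ε , 𝔹.ε
    ; ⊕-identityˡ = λ (a , b) → cong₂ _,_ (𝔸.⊕-identityˡ a) (𝔹.⊕-identityˡ b)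
    ; ⊕-cancelʳ = λ (a , b) (c , d) → cong₂ _,_ (𝔸.⊕-cancelʳ a c) (𝔹.⊕-cancelʳ b d)
    ; _≟_ = Product.≡-dec 𝔸._≟_ 𝔹._≟_
    ; elements = cartesianProduct 𝔸.elements 𝔹.elements
    ; elements-unique = Unique.cartesianProduct⁺ 𝔸.elements-unique 𝔹.elements-unique
    ; ∈-elements = λ (a , b) → ∈-cartesianProductWith⁺ _,_ (𝔸.∈-elements a) (𝔹.∈-elements b)
    ; ∑-translate = translate-pairs
    }

  order-productGroup : FiniteBooleanGroup.order productGroup ≡ 𝔸.order * 𝔹.order
  order-productGroup = length-cartesianProductWith _,_ 𝔸.elements 𝔹.elements

order-vecGroup : ∀ (𝔸 : FiniteBooleanGroup A) n →
  FiniteBooleanGroup.order (vecGroup 𝔸 n) ≡ FiniteBooleanGroup.order 𝔸 ^ n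
order-vecGroup 𝔸 = length-vectors (FiniteBooleanGroup.elements 𝔸)

module _ {Ω G : Set} (𝛀 : FiniteBooleanGroup Ω) (𝔾 : FiniteBooleanGroup G) where
  private
    module 𝛀 = FiniteBooleanGroup 𝛀
    module 𝔾 = FiniteBooleanGroup 𝔾

  Shift : (Ω → G) → Set
  Shift R = Σ (G → Ω) λ s → ∀ ω y → R (ω 𝛀.⊕ s y) ≡ R ω 𝔾.⊕ y

  -- Translation by s y carries the fibre of R over ε onto the fibre over y, so all fibres
  -- have the same size.
  order*kernel≡order : ∀ R → Shift R →
                       𝔾.order * ∑[ ω ← 𝛀.elements ] 𝟙 (𝔾.isε (R ω)) ≡ 𝛀.order
  order*kernel≡order R (s , R-shift) = begin
    𝔾.order * fibre 𝔾.ε                             ≡⟨ ∑-const 𝔾.elements _ ⟨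
    ∑[ y ← 𝔾.elements ] fibre 𝔾.ε                   ≡⟨ ∑-cong 𝔾.elements fibre-ε ⟨
    ∑[ y ← 𝔾.elements ] fibre y                     ≡⟨ ∑-comm 𝛀.elements 𝔾.elements _ ⟨
    ∑[ ω ← 𝛀.elements ] ∑[ y ← 𝔾.elements ] 𝟙 (does (R ω 𝔾.≟ y))
      ≡⟨ ∑-cong 𝛀.elements (λ ω →
           ∑-𝟙-∈-unique 𝔾._≟_ (R ω) 𝔾.elements-unique (𝔾.∈-elements (R ω))) ⟩
    ∑[ _ ← 𝛀.elements ] 1                           ≡⟨ ∑-const 𝛀.elements 1 ⟩
    𝛀.order * 1                                     ≡⟨ *-identityʳ 𝛀.order ⟩
    𝛀.order                                         ∎
    where
    open ≡-Reasoning
    fibre : G → ℕ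
    fibre y = ∑[ ω ← 𝛀.elements ] 𝟙 (does (R ω 𝔾.≟ y))

    fibre-ε : ∀ y → fibre y ≡ fibre 𝔾.ε
    fibre-ε y = begin
      fibre y                                            ≡⟨ 𝛀.∑-translate _ (s y) ⟨
      ∑[ ω ← 𝛀.elements ] 𝟙 (does (R (ω 𝛀.⊕ s y) 𝔾.≟ y)) ≡⟨ ∑-cong 𝛀.elements shifted ⟩
      fibre 𝔾.ε                                          ∎
      where
      shifted : ∀ ω → 𝟙 (does (R (ω 𝛀.⊕ s y) 𝔾.≟ y)) ≡ 𝟙 (does (R ω 𝔾.≟ 𝔾.ε))
      shifted ω rewrite R-shift ω y = cong 𝟙 (does-⇔
        (mk⇔ (λ eq → 𝔾.⊕-≡-cancelʳ y (trans eq (sym (𝔾.⊕-identityˡ y))))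
             (λ { refl → 𝔾.⊕-identityˡ y }))
        (R ω 𝔾.⊕ y 𝔾.≟ y) (R ω 𝔾.≟ 𝔾.ε))

ratio-≤-trans : ∀ {c g i w} x .{{_ : NonZero g}} → c * g ≤ i * w → i * x ≤ g → c * x ≤ w
ratio-≤-trans {c} {g} {i} {w} x cg≤iw ix≤g = *-cancelʳ-≤ (c * x) w g (begin
  c * x * g   ≡⟨ *-assoc c x g ⟩
  c * (x * g) ≡⟨ cong (c *_) (*-comm x g) ⟩
  c * (g * x) ≡⟨ *-assoc c g x ⟨
  c * g * x   ≤⟨ *-monoˡ-≤ x cg≤iw ⟩
  i * w * x   ≡⟨ *-assoc i w x ⟩
  i * (w * x) ≡⟨ cong (i *_) (*-comm w x) ⟩
  i * (x * w) ≡⟨ *-assoc i x w ⟨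
  i * x * w   ≤⟨ *-monoˡ-≤ w ix≤g ⟩
  g * w       ≡⟨ *-comm g w ⟩
  w * g       ∎)
  where open ≤-Reasoning

complement-ratio-bound : ∀ good bad {total} x r → good + bad ≡ total → bad * x ≤ r * total →
            (x ∸ r) * total ≤ good * x
complement-ratio-bound good bad {total} x r partition bad≤ = begin
  (x ∸ r) * total              ≡⟨ *-distribʳ-∸ total x r ⟩
  x * total ∸ r * total        ≤⟨ ∸-monoʳ-≤ (x * total) bad≤ ⟩
  x * total ∸ bad * x          ≡⟨ cong (_∸ bad * x) (*-comm x total) ⟩
  total * x ∸ bad * x          ≡⟨ cong (λ t → t * x ∸ bad * x) partition ⟨
  (good + bad) * x ∸ bad * x   ≡⟨ cong (_∸ bad * x) (*-distribʳ-+ x good bad) ⟩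
  good * x + bad * x ∸ bad * x ≡⟨ m+n∸n≡m (good * x) (bad * x) ⟩
  good * x                     ∎
  where open ≤-Reasoning

module _ {Ω : Set} (𝛀 : FiniteBooleanGroup Ω) where
  private
    module 𝛀 = FiniteBooleanGroup 𝛀

  -- Event e is value e ω ≡ ε, for relevant e only; irrelevant indices never occur but are
  -- still counted by the union bound.
  record EventFamily : Set₁ where
    field
      Index : Set
      indices : List Index
      Relevant : Pred Index _
      relevant? : Decidable Relevant
      Value : Set
      values : FiniteBooleanGroup Value
      value : Index → Ω → Value
      shift : ∀ e → Relevant e → Shift 𝛀 values (value e)

    open FiniteBooleanGroup values using (ε; _≟_; isε; order; order-nonZero)

    occurs : Ω → Index → Bool
    occurs ω e = does (relevant? e) ∧ isε (value e ω)

    happens : Ω → Bool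
    happens ω = any (occurs ω) indices

    occurs-count : ∀ e → ∑[ ω ← 𝛀.elements ] 𝟙 (occurs ω e) * order ≤ 𝛀.order
    occurs-count e with relevant? e
    ... | no _ = ≤-trans (≤-reflexive (cong (_* order) (trans (∑-const 𝛀.elements 0) (*-zeroʳ 𝛀.order)))) z≤n
    ... | yes r = ≤-reflexive (trans (*-comm _ order) (order*kernel≡order 𝛀 values (value e) (shift e r)))

    happens-rarely : ∀ x → length indices * x ≤ order →
                     ∑[ ω ← 𝛀.elements ] 𝟙 (happens ω) * x ≤ 𝛀.order
    happens-rarely x rare =
      ratio-≤-trans {c = ∑[ ω ← 𝛀.elements ] 𝟙 (happens ω)} {i = length indices} x (begin
      ∑[ ω ← 𝛀.elements ] 𝟙 (happens ω) * order
        ≤⟨ *-monoˡ-≤ order (∑-mono 𝛀.elements (λ ω → 𝟙-any (occurs ω) indices)) ⟩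
      ∑[ ω ← 𝛀.elements ] ∑[ e ← indices ] 𝟙 (occurs ω e) * order
        ≡⟨ cong (_* order) (∑-comm 𝛀.elements indices _) ⟩
      ∑[ e ← indices ] ∑[ ω ← 𝛀.elements ] 𝟙 (occurs ω e) * order
        ≡⟨ ∑-*ʳ indices _ order ⟨
      ∑[ e ← indices ] (∑[ ω ← 𝛀.elements ] 𝟙 (occurs ω e) * order)
        ≤⟨ ∑-≤-length* indices 𝛀.order (All.tabulate (λ {e} _ → occurs-count e)) ⟩
      length indices * 𝛀.order ∎) rare
      where open ≤-Reasoning

    value-≢ε : ∀ {ω e} → happens ω ≡ false → e ∈ indices → Relevant e → value e ω ≢ ε
    value-≢ε {ω} {e} none e∈ r value≡ε = case trans (sym occurs-true) (any-false (occurs ω) none e∈) of λ ()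
      where
      occurs-true : occurs ω e ≡ true
      occurs-true = cong₂ _∧_ (dec-true (relevant? e) r) (dec-true (value e ω ≟ ε) value≡ε)

  open EventFamily

  anyHappens : List EventFamily → Ω → Bool
  anyHappens Fs ω = any (λ F → happens F ω) Fs

  avoiding : List EventFamily → List Ω
  avoiding Fs = filterᵇ (not ∘ anyHappens Fs) 𝛀.elements

  union-bound : ∀ Fs x → All (λ F → length (indices F) * x ≤ FiniteBooleanGroup.order (values F)) Fs →
                (x ∸ length Fs) * 𝛀.order ≤ length (avoiding Fs) * x
  union-bound Fs x rare =
    complement-ratio-bound (length (avoiding Fs)) (∑[ ω ← 𝛀.elements ] 𝟙 (anyHappens Fs ω)) x (length Fs)
      (length-filterᵇ-not+∑-𝟙 (anyHappens Fs) 𝛀.elements) (begin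
      ∑[ ω ← 𝛀.elements ] 𝟙 (anyHappens Fs ω) * x
        ≤⟨ *-monoˡ-≤ x (∑-mono 𝛀.elements (λ ω → 𝟙-any (λ F → happens F ω) Fs)) ⟩
      ∑[ ω ← 𝛀.elements ] ∑[ F ← Fs ] 𝟙 (happens F ω) * x
        ≡⟨ cong (_* x) (∑-comm 𝛀.elements Fs _) ⟩
      ∑[ F ← Fs ] ∑[ ω ← 𝛀.elements ] 𝟙 (happens F ω) * x
        ≡⟨ ∑-*ʳ Fs _ x ⟨
      ∑[ F ← Fs ] (∑[ ω ← 𝛀.elements ] 𝟙 (happens F ω) * x)
        ≤⟨ ∑-≤-length* Fs 𝛀.order (All.map (λ {F} → happens-rarely F x) rare) ⟩
      length Fs * 𝛀.order ∎)
    where open ≤-Reasoning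

  avoiding-unique : ∀ Fs → Unique (avoiding Fs)
  avoiding-unique Fs = Unique.filter⁺ (T? ∘ not ∘ anyHappens Fs) 𝛀.elements-unique

  avoiding-avoids : ∀ Fs → All (T ∘ not ∘ anyHappens Fs) (avoiding Fs)
  avoiding-avoids Fs = Allₚ.all-filter (T? ∘ not ∘ anyHappens Fs) 𝛀.elements

  anyHappens-false : ∀ {Fs ω F} → T (not (anyHappens Fs ω)) → F ∈ Fs → happens F ω ≡ false
  anyHappens-false {Fs} {ω} avoids = any-false (λ F → happens F ω) (Equivalence.to T-not-≡ avoids)

𝔽 : ∀ n → FiniteBooleanGroup (F2^ n)
𝔽 = vecGroup boolGroup

+v-self : ∀ {n} (x : F2^ n) → x +v x ≡ 0v
+v-self {n} = FiniteBooleanGroup.⊕-self (𝔽 n)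

+v-identityˡ : ∀ {n} (x : F2^ n) → 0v +v x ≡ x
+v-identityˡ {n} = FiniteBooleanGroup.⊕-identityˡ (𝔽 n)

+v-comm : ∀ {n} (x y : F2^ n) → x +v y ≡ y +v x
+v-comm = Vecₚ.zipWith-comm xor-comm

+v-assoc : ∀ {n} (x y z : F2^ n) → (x +v y) +v z ≡ x +v (y +v z)
+v-assoc = Vecₚ.zipWith-assoc xor-assoc

+v-identityʳ : ∀ {n} (x : F2^ n) → x +v 0v ≡ x
+v-identityʳ = Vecₚ.zipWith-identityʳ xor-identityʳ

+v-interchange : ∀ {n} (a b c d : F2^ n) → (a +v b) +v (c +v d) ≡ (a +v c) +v (b +v d)
+v-interchange [] [] [] [] = refl
+v-interchange (a ∷ as) (b ∷ bs) (c ∷ cs) (d ∷ ds) =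
  cong₂ _∷_ (xor-interchange a b c d) (+v-interchange as bs cs ds)

+v-swapʳ : ∀ {n} (a b c : F2^ n) → (a +v b) +v c ≡ (a +v c) +v b
+v-swapʳ a b c = trans (+v-assoc a b c) (trans (cong (a +v_) (+v-comm b c)) (sym (+v-assoc a c b)))

scale-+v : ∀ {n} b (x y : F2^ n) → scale b (x +v y) ≡ scale b x +v scale b y
scale-+v b [] [] = refl
scale-+v b (x ∷ xs) (y ∷ ys) = cong₂ _∷_ (∧-distribˡ-xor b x y) (scale-+v b xs ys)

scale-false : ∀ {n} (x : F2^ n) → scale false x ≡ 0v
scale-false x = Vecₚ.map-const x false

scale-true : ∀ {n} (x : F2^ n) → scale true x ≡ x
scale-true = Vecₚ.map-id

scale-0v : ∀ {n} b → scale b (0v {n}) ≡ 0v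
scale-0v {n} b = trans (Vecₚ.map-replicate (b ∧_) false n) (cong (replicate n) (∧-zeroʳ b))

dot-+v : ∀ {n} (v w w′ : F2^ n) → dot v (w +v w′) ≡ dot v w xor dot v w′
dot-+v [] [] [] = refl
dot-+v (a ∷ v) (b ∷ w) (b′ ∷ w′) =
  trans (cong₂ _xor_ (∧-distribˡ-xor a b b′) (dot-+v v w w′))
        (xor-interchange (a ∧ b) (a ∧ b′) (dot v w) (dot v w′))

dot-0v : ∀ {n} (v : F2^ n) → dot v 0v ≡ false
dot-0v [] = refl
dot-0v (a ∷ v) = trans (cong (_xor dot v 0v) (∧-zeroʳ a)) (dot-0v v)

dot-scale : ∀ {n} (v u : F2^ n) b → dot v (scale b u) ≡ b ∧ dot v u
dot-scale v u false = trans (cong (dot v) (scale-false u)) (dot-0v v)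
dot-scale v u true = cong (dot v) (scale-true u)

dual-witness : ∀ {n} (v : F2^ n) → v ≢ 0v → Σ (F2^ n) λ u → dot v u ≡ true
dual-witness [] v≢0 = ⊥-elim (v≢0 refl)
dual-witness (true ∷ v) _ = true ∷ 0v , cong not (dot-0v v)
dual-witness (false ∷ v) v≢0 with dual-witness v (v≢0 ∘ cong (false ∷_))
... | u , vu≡true = false ∷ u , vu≡true

nonzero-witness : ∀ {m} (c : Vec Bool m) → c ≢ replicate m false → Σ (Fin m) λ t → lookup c t ≡ true
nonzero-witness [] c≢0 = ⊥-elim (c≢0 refl)
nonzero-witness (true ∷ c) _ = fzero , refl
nonzero-witness (false ∷ c) c≢0 with nonzero-witness c (c≢0 ∘ cong (false ∷_))
... | t , ct≡true = fsuc t , ct≡true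

single : ∀ {X : Set} {p} → X → Fin p → X → Fin p → X
single {p = p} x₀ i x = lookup (replicate p x₀ [ i ]≔ x)

single-≡ : ∀ {X : Set} {p} (x₀ : X) (i : Fin p) x → single x₀ i x i ≡ x
single-≡ {p = p} x₀ i x = Vecₚ.lookup∘update i (replicate p x₀) x

single-≢ : ∀ {X : Set} {p} (x₀ : X) {i j : Fin p} x → j ≢ i → single x₀ i x j ≡ x₀
single-≢ {p = p} x₀ {i} {j} x j≢i =
  trans (Vecₚ.lookup∘update′ j≢i (replicate p x₀) x) (Vecₚ.lookup-replicate j x₀)

lincomb-cong : ∀ {n m} {f g : Fin m → F2^ n} → (∀ s → f s ≡ g s) → ∀ c → lincomb f c ≡ lincomb g c
lincomb-cong {m = zero} f≗g [] = refl
lincomb-cong {m = suc m} f≗g (b ∷ c) = cong₂ _+v_ (cong (scale b) (f≗g fzero)) (lincomb-cong (f≗g ∘ fsuc) c)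

lincomb-zeros : ∀ {n m} (f : Fin m → F2^ n) → lincomb f (replicate m false) ≡ 0v
lincomb-zeros {m = zero} f = refl
lincomb-zeros {m = suc m} f =
  trans (cong₂ _+v_ (scale-false (f fzero)) (lincomb-zeros (f ∘ fsuc))) (+v-self 0v)

lincomb-0v : ∀ {n m} (c : Vec Bool m) → lincomb {n} (λ _ → 0v) c ≡ 0v
lincomb-0v [] = refl
lincomb-0v (b ∷ c) = trans (cong₂ _+v_ (scale-0v b) (lincomb-0v c)) (+v-self 0v)

lincomb-+v : ∀ {n m} (f g : Fin m → F2^ n) c → lincomb (λ s → f s +v g s) c ≡ lincomb f c +v lincomb g c
lincomb-+v {m = zero} f g [] = sym (+v-self 0v)
lincomb-+v {m = suc m} f g (b ∷ c) =
  trans (cong₂ _+v_ (scale-+v b (f fzero) (g fzero)) (lincomb-+v (f ∘ fsuc) (g ∘ fsuc) c))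
        (+v-interchange _ _ _ _)

lincomb-single : ∀ {n m} (t : Fin m) (y : F2^ n) c → lincomb (single 0v t y) c ≡ scale (lookup c t) y
lincomb-single fzero y (b ∷ c) =
  trans (cong (scale b y +v_) (trans (lincomb-cong (λ s → Vecₚ.lookup-replicate s 0v) c) (lincomb-0v c)))
        (+v-identityʳ _)
lincomb-single (fsuc t) y (b ∷ c) = trans (cong₂ _+v_ (scale-0v b) (lincomb-single t y c)) (+v-identityˡ _)

lincomb-unit : ∀ {n m} (f : Fin m → F2^ n) t → lincomb f (replicate m false [ t ]≔ true) ≡ f t
lincomb-unit {m = suc m} f fzero =
  trans (cong₂ _+v_ (scale-true (f fzero)) (lincomb-zeros (f ∘ fsuc))) (+v-identityʳ _)
lincomb-unit {m = suc m} f (fsuc t) =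
  trans (cong₂ _+v_ (scale-false (f fzero)) (lincomb-unit (f ∘ fsuc) t)) (+v-identityˡ _)

∈-Span-generator : ∀ {n m} (f : Fin m → F2^ n) t → Span f (f t)
∈-Span-generator {m = m} f t = replicate m false [ t ]≔ true , lincomb-unit f t

module _ {X : Set} (_≟_ : DecidableEquality A) (x₀ : X) where

  place : ∀ {p} → Vec A p → Vec X p → A → X
  place [] [] a = x₀
  place (i ∷ I) (x ∷ xs) a with i ≟ a
  ... | yes _ = x
  ... | no _ = place I xs a

  place-lookup : ∀ {p} (I : Vec A p) → Unique (toList I) → ∀ xs s → place I xs (lookup I s) ≡ lookup xs s
  place-lookup (i ∷ I) u (x ∷ xs) fzero with i ≟ i
  ... | yes _ = refl
  ... | no i≢i = ⊥-elim (i≢i refl)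
  place-lookup (i ∷ I) (i∉I AllPairs.∷ u) (x ∷ xs) (fsuc s) with i ≟ lookup I s
  ... | yes i≡Is = ⊥-elim (All.lookup i∉I (∈-toList⁺ (∈-lookup s I)) i≡Is)
  ... | no _ = place-lookup I u xs s

zipWith-tabulate : ∀ {p} (g : A → B → C) (f : Fin p → A) ys →
                   zipWith g (tabulate f) ys ≡ tabulate (λ s → g (f s) (lookup ys s))
zipWith-tabulate g f [] = refl
zipWith-tabulate g f (y ∷ ys) = cong (g (f fzero) y ∷_) (zipWith-tabulate g (f ∘ fsuc) ys)

tabulate-const : ∀ {p} (x : A) → tabulate {n = p} (λ _ → x) ≡ replicate p x
tabulate-const x = trans (Vecₚ.tabulate-allFin _) (Vecₚ.map-const _ x)

short-or-prefix : ∀ r (L : List A) → length L ≤ r ⊎ Σ (Vec A (suc r)) λ I → toList I ≡ take (suc r) L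
short-or-prefix r [] = inj₁ z≤n
short-or-prefix zero (x ∷ L) = inj₂ (x ∷ [] , refl)
short-or-prefix (suc r) (x ∷ L) with short-or-prefix r L
... | inj₁ short = inj₁ (s≤s short)
... | inj₂ (I , I≡L) = inj₂ (x ∷ I , cong (x ∷_) I≡L)

module Samples (n m N : ℕ) where

  Block : Set
  Block = F2^ n × Vec (F2^ n) m

  𝛀 : FiniteBooleanGroup (Vec Block N)
  𝛀 = vecGroup (productGroup (𝔽 n) (vecGroup (𝔽 n) m)) N

  open FiniteBooleanGroup 𝛀 using (_⊕_)

  translation : Vec Block N → Fin N → F2^ n
  translation ω i = proj₁ (lookup ω i)

  generators : Vec Block N → Fin N → Fin m → F2^ n
  generators ω i = lookup (proj₂ (lookup ω i))

  generatorShift : (Fin N → Fin m → F2^ n) → Vec Block N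
  generatorShift δ = tabulate λ i → 0v , tabulate (δ i)

  translationShift : (Fin N → F2^ n) → Vec Block N
  translationShift α = tabulate λ i → α i , replicate m 0v

  translation-⊕ : ∀ ω ω′ i → translation (ω ⊕ ω′) i ≡ translation ω i +v translation ω′ i
  translation-⊕ ω ω′ i = cong proj₁ (Vecₚ.lookup-zipWith _ i ω ω′)

  generators-⊕ : ∀ ω ω′ i t → generators (ω ⊕ ω′) i t ≡ generators ω i t +v generators ω′ i t
  generators-⊕ ω ω′ i t = trans (cong (λ b → lookup (proj₂ b) t) (Vecₚ.lookup-zipWith _ i ω ω′))
                                (Vecₚ.lookup-zipWith _ t (proj₂ (lookup ω i)) (proj₂ (lookup ω′ i)))

  generators-generatorShift : ∀ ω δ i t → generators (ω ⊕ generatorShift δ) i t ≡ generators ω i t +v δ i t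
  generators-generatorShift ω δ i t = trans (generators-⊕ ω _ i t) (cong (generators ω i t +v_)
    (trans (cong (λ b → lookup (proj₂ b) t) (Vecₚ.lookup∘tabulate _ i)) (Vecₚ.lookup∘tabulate (δ i) t)))

  lincomb-generatorShift : ∀ ω δ i c →
    lincomb (generators (ω ⊕ generatorShift δ) i) c ≡ lincomb (generators ω i) c +v lincomb (δ i) c
  lincomb-generatorShift ω δ i c =
    trans (lincomb-cong (generators-generatorShift ω δ i) c) (lincomb-+v _ _ c)

  translation-translationShift : ∀ ω α i → translation (ω ⊕ translationShift α) i ≡ translation ω i +v α i
  translation-translationShift ω α i =
    trans (translation-⊕ ω _ i) (cong (λ b → translation ω i +v proj₁ b) (Vecₚ.lookup∘tabulate _ i))

  lincomb-translationShift : ∀ ω α i c →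
    lincomb (generators (ω ⊕ translationShift α) i) c ≡ lincomb (generators ω i) c
  lincomb-translationShift ω α i = lincomb-cong λ t → begin
    generators (ω ⊕ translationShift α) i t                ≡⟨ generators-⊕ ω _ i t ⟩
    generators ω i t +v generators (translationShift α) i t
      ≡⟨ cong (λ b → generators ω i t +v lookup (proj₂ b) t) (Vecₚ.lookup∘tabulate _ i) ⟩
    generators ω i t +v lookup (replicate m 0v) t          ≡⟨ cong (generators ω i t +v_) (Vecₚ.lookup-replicate t 0v) ⟩
    generators ω i t +v 0v                                 ≡⟨ +v-identityʳ _ ⟩
    generators ω i t                                       ∎
    where open ≡-Reasoning

  pointShift : Fin N → Fin m → F2^ n → Vec Block N
  pointShift i t y = generatorShift (single (λ _ → 0v) i (single 0v t y))

  lincomb-pointShift-≡ : ∀ ω i {t} y c → lookup c t ≡ true →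
    lincomb (generators (ω ⊕ pointShift i t y) i) c ≡ lincomb (generators ω i) c +v y
  lincomb-pointShift-≡ ω i {t} y c ct≡true = begin
    lincomb (generators (ω ⊕ pointShift i t y) i) c
      ≡⟨ lincomb-generatorShift ω _ i c ⟩
    lincomb (generators ω i) c +v lincomb (single (λ _ → 0v) i (single 0v t y) i) c
      ≡⟨ cong (λ f → lincomb (generators ω i) c +v lincomb f c) (single-≡ _ i _) ⟩
    lincomb (generators ω i) c +v lincomb (single 0v t y) c
      ≡⟨ cong (lincomb (generators ω i) c +v_) (lincomb-single t y c) ⟩
    lincomb (generators ω i) c +v scale (lookup c t) y
      ≡⟨ cong (λ b → lincomb (generators ω i) c +v scale b y) ct≡true ⟩
    lincomb (generators ω i) c +v scale true y
      ≡⟨ cong (lincomb (generators ω i) c +v_) (scale-true y) ⟩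
    lincomb (generators ω i) c +v y ∎
    where open ≡-Reasoning

  lincomb-pointShift-≢ : ∀ ω {i j} t y d → j ≢ i →
    lincomb (generators (ω ⊕ pointShift i t y) j) d ≡ lincomb (generators ω j) d
  lincomb-pointShift-≢ ω {i} {j} t y d j≢i = begin
    lincomb (generators (ω ⊕ pointShift i t y) j) d
      ≡⟨ lincomb-generatorShift ω _ j d ⟩
    lincomb (generators ω j) d +v lincomb (single (λ _ → 0v) i (single 0v t y) j) d
      ≡⟨ cong (λ f → lincomb (generators ω j) d +v lincomb f d) (single-≢ _ _ j≢i) ⟩
    lincomb (generators ω j) d +v lincomb (λ _ → 0v) d
      ≡⟨ cong (lincomb (generators ω j) d +v_) (lincomb-0v d) ⟩
    lincomb (generators ω j) d +v 0v
      ≡⟨ +v-identityʳ _ ⟩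
    lincomb (generators ω j) d ∎
    where open ≡-Reasoning

  private
    𝔽ᵐ : List (F2^ m)
    𝔽ᵐ = FiniteBooleanGroup.elements (𝔽 m)

    _≟ᵐ_ : DecidableEquality (F2^ m)
    _≟ᵐ_ = FiniteBooleanGroup._≟_ (𝔽 m)

    _≟ⁿ_ : DecidableEquality (F2^ n)
    _≟ⁿ_ = FiniteBooleanGroup._≟_ (𝔽 n)

    ∈-𝔽 : ∀ k (v : F2^ k) → v ∈ FiniteBooleanGroup.elements (𝔽 k)
    ∈-𝔽 k = FiniteBooleanGroup.∈-elements (𝔽 k)

  dependence : EventFamily 𝛀
  dependence = record
    { Index = Fin N × F2^ m
    ; indices = cartesianProduct (allFin N) 𝔽ᵐ
    ; Relevant = λ (_ , c) → c ≢ 0v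
    ; relevant? = λ (_ , c) → ¬? (c ≟ᵐ 0v)
    ; Value = F2^ n
    ; values = 𝔽 n
    ; value = λ (i , c) ω → lincomb (generators ω i) c
    ; shift = shift
    }
    where
    shift : ∀ ((i , c) : Fin N × F2^ m) → c ≢ 0v → Shift 𝛀 (𝔽 n) (λ ω → lincomb (generators ω i) c)
    shift (i , c) c≢0 = let t , ct≡true = nonzero-witness c c≢0 in
      pointShift i t , λ ω y → lincomb-pointShift-≡ ω i y c ct≡true

  cosetPoint : Vec Block N → Fin N → F2^ m → F2^ n
  cosetPoint ω i c = lincomb (generators ω i) c +v translation ω i

  cosetPoint-translationShift : ∀ ω α i c →
    cosetPoint (ω ⊕ translationShift α) i c ≡ cosetPoint ω i c +v α i
  cosetPoint-translationShift ω α i c = begin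
    cosetPoint (ω ⊕ translationShift α) i c
      ≡⟨ cong₂ _+v_ (lincomb-translationShift ω α i c) (translation-translationShift ω α i) ⟩
    lincomb (generators ω i) c +v (translation ω i +v α i)
      ≡⟨ +v-assoc _ _ _ ⟨
    cosetPoint ω i c +v α i ∎
    where open ≡-Reasoning

  PairIndex : Set
  PairIndex = Fin N × Fin N × F2^ m × F2^ m

  private
    pairIndices : List PairIndex
    pairIndices = cartesianProduct (allFin N) (cartesianProduct (allFin N) (cartesianProduct 𝔽ᵐ 𝔽ᵐ))

    pairIndex∈ : ∀ i j c d → (i , j , c , d) ∈ pairIndices
    pairIndex∈ i j c d = ∈-cartesianProduct⁺ (∈-allFin i) (∈-cartesianProduct⁺ (∈-allFin j)
                           (∈-cartesianProduct⁺ (∈-𝔽 m c) (∈-𝔽 m d)))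

  cosetsMeeting : EventFamily 𝛀
  cosetsMeeting = record
    { Index = PairIndex
    ; indices = pairIndices
    ; Relevant = λ (i , j , _) → i ≢ j
    ; relevant? = λ (i , j , _) → ¬? (i Fin.≟ j)
    ; Value = F2^ n
    ; values = 𝔽 n
    ; value = λ (i , j , c , d) ω → cosetPoint ω i c +v cosetPoint ω j d
    ; shift = shift
    }
    where
    shift : ∀ ((i , j , c , d) : PairIndex) → i ≢ j →
            Shift 𝛀 (𝔽 n) (λ ω → cosetPoint ω i c +v cosetPoint ω j d)
    shift (i , j , c , d) i≢j = translationShift ∘ single 0v i , λ ω y → begin
      cosetPoint (ω ⊕ translationShift (single 0v i y)) i c +v cosetPoint (ω ⊕ translationShift (single 0v i y)) j d
        ≡⟨ cong₂ _+v_ (cosetPoint-translationShift ω _ i c) (cosetPoint-translationShift ω _ j d) ⟩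
      (cosetPoint ω i c +v single 0v i y i) +v (cosetPoint ω j d +v single 0v i y j)
        ≡⟨ cong₂ (λ a b → (cosetPoint ω i c +v a) +v (cosetPoint ω j d +v b))
                 (single-≡ 0v i y) (single-≢ 0v y (i≢j ∘ sym)) ⟩
      (cosetPoint ω i c +v y) +v (cosetPoint ω j d +v 0v)
        ≡⟨ cong ((cosetPoint ω i c +v y) +v_) (+v-identityʳ _) ⟩
      (cosetPoint ω i c +v y) +v cosetPoint ω j d
        ≡⟨ +v-swapʳ _ _ _ ⟩
      (cosetPoint ω i c +v cosetPoint ω j d) +v y ∎
      where open ≡-Reasoning

  spansMeeting : EventFamily 𝛀
  spansMeeting = record
    { Index = PairIndex
    ; indices = pairIndices
    ; Relevant = λ (i , j , c , _) → i ≢ j × c ≢ 0v  -- for c ≡ 0v the common point is 0v anyway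
    ; relevant? = λ (i , j , c , _) → ¬? (i Fin.≟ j) ×-dec ¬? (c ≟ᵐ 0v)
    ; Value = F2^ n
    ; values = 𝔽 n
    ; value = λ (i , j , c , d) ω → lincomb (generators ω i) c +v lincomb (generators ω j) d
    ; shift = shift
    }
    where
    shift : ∀ ((i , j , c , d) : PairIndex) → i ≢ j × c ≢ 0v →
            Shift 𝛀 (𝔽 n) (λ ω → lincomb (generators ω i) c +v lincomb (generators ω j) d)
    shift (i , j , c , d) (i≢j , c≢0) = let t , ct≡true = nonzero-witness c c≢0 in
      pointShift i t , λ ω y →
        trans (cong₂ _+v_ (lincomb-pointShift-≡ ω i y c ct≡true) (lincomb-pointShift-≢ ω t y d (i≢j ∘ sym)))
              (+v-swapʳ _ _ _)

  dotPattern : ∀ {r} → F2^ n → Vec (Fin N) r → Vec Block N → Vec (F2^ m) r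
  dotPattern v I ω = tabulate λ s → tabulate λ t → dot v (generators ω (lookup I s) t)

  -- Adds (y_s)_t · u to generator t of block I_s; as v · u = 1 this adds y to the pattern.
  patternShift : ∀ {r} → F2^ n → Vec (Fin N) r → Vec (F2^ m) r → Vec Block N
  patternShift u I y = generatorShift λ j t → scale (lookup (place Fin._≟_ 0v I y j) t) u

  dotPattern-patternShift : ∀ {r} v (I : Vec (Fin N) r) → Unique (toList I) →
    ∀ {u} → dot v u ≡ true → ∀ ω y →
    dotPattern v I (ω ⊕ patternShift u I y) ≡ zipWith (zipWith _xor_) (dotPattern v I ω) y
  dotPattern-patternShift v I I-unique {u} vu≡true ω y = begin
    dotPattern v I (ω ⊕ patternShift u I y)
      ≡⟨ Vecₚ.tabulate-cong (λ s → Vecₚ.tabulate-cong (shifted s)) ⟩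
    tabulate (λ s → tabulate λ t → dot v (generators ω (lookup I s) t) xor lookup (lookup y s) t)
      ≡⟨ Vecₚ.tabulate-cong (λ s → zipWith-tabulate _xor_ _ (lookup y s)) ⟨
    tabulate (λ s → zipWith _xor_ (tabulate λ t → dot v (generators ω (lookup I s) t)) (lookup y s))
      ≡⟨ zipWith-tabulate (zipWith _xor_) _ y ⟨
    zipWith (zipWith _xor_) (dotPattern v I ω) y ∎
    where
    open ≡-Reasoning
    shifted : ∀ s t → dot v (generators (ω ⊕ patternShift u I y) (lookup I s) t)
                        ≡ dot v (generators ω (lookup I s) t) xor lookup (lookup y s) t
    shifted s t = begin
      dot v (generators (ω ⊕ patternShift u I y) (lookup I s) t)
        ≡⟨ cong (dot v) (generators-generatorShift ω _ (lookup I s) t) ⟩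
      dot v (w +v scale (lookup (place Fin._≟_ 0v I y (lookup I s)) t) u)
        ≡⟨ cong (λ c → dot v (w +v scale (lookup c t) u)) (place-lookup Fin._≟_ 0v I I-unique y s) ⟩
      dot v (w +v scale (lookup (lookup y s) t) u)
        ≡⟨ dot-+v v _ _ ⟩
      dot v w xor dot v (scale (lookup (lookup y s) t) u)
        ≡⟨ cong (dot v w xor_) (trans (dot-scale v u _) (cong (_ ∧_) vu≡true)) ⟩
      dot v w xor (lookup (lookup y s) t ∧ true)
        ≡⟨ cong (dot v w xor_) (∧-identityʳ _) ⟩
      dot v w xor lookup (lookup y s) t ∎
      where
      w : F2^ n
      w = generators ω (lookup I s) t

  perpendicularTuples : ℕ → EventFamily 𝛀
  perpendicularTuples r = record
    { Index = F2^ n × Vec (Fin N) r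
    ; indices = cartesianProduct (FiniteBooleanGroup.elements (𝔽 n)) (vectors (allFin N) r)
    ; Relevant = λ (v , I) → v ≢ 0v × Unique (toList I)
    ; relevant? = λ (v , I) → ¬? (v ≟ⁿ 0v) ×-dec unique? Fin._≟_ (toList I)
    ; Value = Vec (F2^ m) r
    ; values = vecGroup (𝔽 m) r
    ; value = λ (v , I) → dotPattern v I
    ; shift = λ (v , I) (v≢0 , I-unique) → let u , vu≡true = dual-witness v v≢0 in
        patternShift u I , dotPattern-patternShift v I I-unique vu≡true
    }

  open EventFamily using (happens; value-≢ε)

  generators-independent : ∀ {ω} → happens dependence ω ≡ false → ∀ i → LinIndep (generators ω i)
  generators-independent {ω} none i c lc≡0 with c ≟ᵐ 0v
  ... | yes c≡0 = c≡0
  ... | no c≢0 = ⊥-elim (value-≢ε dependence {ω} none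
                           (∈-cartesianProduct⁺ (∈-allFin i) (∈-𝔽 m c)) c≢0 lc≡0)

  cosets-disjoint : ∀ {ω} → happens cosetsMeeting ω ≡ false → ∀ i j → i ≢ j →
    ¬ (Σ (F2^ n) λ x → Coset (Span (generators ω i)) (translation ω i) x
                     × Coset (Span (generators ω j)) (translation ω j) x)
  cosets-disjoint {ω} none i j i≢j (x , (u , (c , c↦u) , x≡u+a) , (u′ , (d , d↦u′) , x≡u′+a′)) =
    value-≢ε cosetsMeeting {ω} none (pairIndex∈ i j c d) i≢j (begin
      cosetPoint ω i c +v cosetPoint ω j d
        ≡⟨ cong₂ _+v_ (cong (_+v translation ω i) c↦u) (cong (_+v translation ω j) d↦u′) ⟩
      (u +v translation ω i) +v (u′ +v translation ω j)
        ≡⟨ cong₂ _+v_ x≡u+a x≡u′+a′ ⟨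
      x +v x
        ≡⟨ +v-self x ⟩
      0v ∎)
    where open ≡-Reasoning

  spans-meet-trivially : ∀ {ω} → happens spansMeeting ω ≡ false → ∀ i j → i ≢ j →
    ∀ x → Span (generators ω i) x → Span (generators ω j) x → x ≡ 0v
  spans-meet-trivially {ω} none i j i≢j x (c , c↦x) (d , d↦x) with c ≟ᵐ 0v
  ... | yes refl = trans (sym c↦x) (lincomb-zeros (generators ω i))
  ... | no c≢0 = ⊥-elim (value-≢ε spansMeeting {ω} none (pairIndex∈ i j c d) (i≢j , c≢0)
                           (trans (cong₂ _+v_ c↦x d↦x) (+v-self x)))

  few-perpendicular : ∀ {ω r} → happens (perpendicularTuples (suc r)) ω ≡ false → ∀ v → v ≢ 0v →
    ∀ L → Unique L → All (λ i → Perp (Span (generators ω i)) v) L → length L ≤ r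
  few-perpendicular {ω} {r} none v v≢0 L L-unique L-perp with short-or-prefix r L
  ... | inj₁ short = short
  ... | inj₂ (I , I≡L) = ⊥-elim (value-≢ε (perpendicularTuples (suc r)) {ω} none
          (∈-cartesianProduct⁺ (∈-𝔽 n v) (∈-vectors ∈-allFin I)) (v≢0 , I-unique) pattern≡0)
    where
    I-unique : Unique (toList I)
    I-unique = subst Unique (sym I≡L) (Unique.take⁺ (suc r) L-unique)

    I-perp : ∀ s → Perp (Span (generators ω (lookup I s))) v
    I-perp s = All.lookup (subst (All _) (sym I≡L) (Allₚ.take⁺ (suc r) L-perp)) (∈-toList⁺ (∈-lookup s I))

    pattern≡0 : dotPattern v I ω ≡ replicate (suc r) (replicate m false)
    pattern≡0 = begin
      dotPattern v I ω
        ≡⟨ Vecₚ.tabulate-cong (λ s → Vecₚ.tabulate-cong λ t → I-perp s _ (∈-Span-generator _ t)) ⟩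
      tabulate (λ _ → tabulate λ _ → false)
        ≡⟨ Vecₚ.tabulate-cong (λ _ → tabulate-const false) ⟩
      tabulate (λ _ → replicate m false)
        ≡⟨ tabulate-const _ ⟩
      replicate (suc r) (replicate m false) ∎
      where open ≡-Reasoning

  families : List (EventFamily 𝛀)
  families = dependence ∷ cosetsMeeting ∷ spansMeeting ∷ perpendicularTuples 8 ∷ []

  private
    open EventFamily using (indices; values)

    order : ∀ {A} → FiniteBooleanGroup A → ℕ
    order = FiniteBooleanGroup.order

    length-allFin : length (allFin N) ≡ N
    length-allFin = length-tabulate id

    order-𝔽 : ∀ k → order (𝔽 k) ≡ 2 ^ k
    order-𝔽 = order-vecGroup boolGroup

  order-𝛀 : order 𝛀 ≡ 2 ^ (n * (1 + m) * N)
  order-𝛀 = begin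
    order 𝛀                          ≡⟨ order-vecGroup (productGroup (𝔽 n) (vecGroup (𝔽 n) m)) N ⟩
    order (productGroup (𝔽 n) (vecGroup (𝔽 n) m)) ^ N
      ≡⟨ cong (_^ N) (order-productGroup (𝔽 n) (vecGroup (𝔽 n) m)) ⟩
    (order (𝔽 n) * order (vecGroup (𝔽 n) m)) ^ N
      ≡⟨ cong (_^ N) (cong₂ _*_ (order-𝔽 n) (trans (order-vecGroup (𝔽 n) m) (cong (_^ m) (order-𝔽 n)))) ⟩
    (2 ^ n * (2 ^ n) ^ m) ^ N        ≡⟨ cong (λ e → (2 ^ n * e) ^ N) (^-*-assoc 2 n m) ⟩
    (2 ^ n * 2 ^ (n * m)) ^ N        ≡⟨ cong (_^ N) (^-distribˡ-+-* 2 n (n * m)) ⟨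
    (2 ^ (n + n * m)) ^ N            ≡⟨ cong (λ e → (2 ^ e) ^ N) (*-suc n m) ⟨
    (2 ^ (n * (1 + m))) ^ N          ≡⟨ ^-*-assoc 2 (n * (1 + m)) N ⟩
    2 ^ (n * (1 + m) * N)            ∎
    where open ≡-Reasoning

  families-rare : ∀ x → N * 2 ^ m * x ≤ 2 ^ n → N * (N * (2 ^ m * 2 ^ m)) * x ≤ 2 ^ n →
    2 ^ n * N ^ 8 * x ≤ (2 ^ m) ^ 8 → All (λ F → length (indices F) * x ≤ order (values F)) families
  families-rare x dependence-rare meeting-rare perpendicular-rare =
    rare dependence length-dependence (order-𝔽 n) dependence-rare ∷
    rare cosetsMeeting length-pairIndices (order-𝔽 n) meeting-rare ∷
    rare spansMeeting length-pairIndices (order-𝔽 n) meeting-rare ∷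
    rare (perpendicularTuples 8) length-perpendicular order-patterns perpendicular-rare ∷ []
    where
    rare : ∀ (F : EventFamily 𝛀) {l o} → length (indices F) ≡ l → order (values F) ≡ o → l * x ≤ o →
           length (indices F) * x ≤ order (values F)
    rare F refl refl l*x≤o = l*x≤o

    length-dependence : length (indices dependence) ≡ N * 2 ^ m
    length-dependence =
      trans (length-cartesianProductWith _,_ (allFin N) 𝔽ᵐ) (cong₂ _*_ length-allFin (order-𝔽 m))

    length-perpendicular : length (indices (perpendicularTuples 8)) ≡ 2 ^ n * N ^ 8
    length-perpendicular = trans (length-cartesianProductWith _,_ (FiniteBooleanGroup.elements (𝔽 n)) _)
      (cong₂ _*_ (order-𝔽 n) (trans (length-vectors (allFin N) 8) (cong (_^ 8) length-allFin)))

    order-patterns : order (values (perpendicularTuples 8)) ≡ (2 ^ m) ^ 8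
    order-patterns = trans (order-vecGroup (𝔽 m) 8) (cong (_^ 8) (order-𝔽 m))

    length-pairIndices : length pairIndices ≡ N * (N * (2 ^ m * 2 ^ m))
    length-pairIndices = trans (length-cartesianProductWith _,_ (allFin N) _) (cong₂ _*_ length-allFin
      (trans (length-cartesianProductWith _,_ (allFin N) _) (cong₂ _*_ length-allFin
        (trans (length-cartesianProductWith _,_ 𝔽ᵐ 𝔽ᵐ) (cong₂ _*_ (order-𝔽 m) (order-𝔽 m))))))

2^[e*k]≡[2^k]^e : ∀ e k → 2 ^ (e * k) ≡ (2 ^ k) ^ e
2^[e*k]≡[2^k]^e e k = trans (cong (2 ^_) (*-comm e k)) (sym (^-*-assoc 2 k e))

module Rarity (k : ℕ) where
  open +-*-Solver

  private
    X : ℕ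
    X = 2 ^ k

  dependence-rare : 2 ^ k * 2 ^ (2 * k) * 2 ^ k ≤ 2 ^ (7 * k)
  dependence-rare rewrite 2^[e*k]≡[2^k]^e 2 k | 2^[e*k]≡[2^k]^e 7 k = begin
    X * X ^ 2 * X ≡⟨ solve 1 (λ x → x :* x :^ 2 :* x := x :^ 4) refl X ⟩
    X ^ 4         ≤⟨ ^-monoʳ-≤ X {{m^n≢0 2 k}} (m≤m+n 4 3) ⟩
    X ^ 7         ∎
    where open ≤-Reasoning

  meeting-rare : 2 ^ k * (2 ^ k * (2 ^ (2 * k) * 2 ^ (2 * k))) * 2 ^ k ≤ 2 ^ (7 * k)
  meeting-rare rewrite 2^[e*k]≡[2^k]^e 2 k | 2^[e*k]≡[2^k]^e 7 k =
    ≤-reflexive (solve 1 (λ x → x :* (x :* (x :^ 2 :* x :^ 2)) :* x := x :^ 7) refl X)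

  perpendicular-rare : 2 ^ (7 * k) * (2 ^ k) ^ 8 * 2 ^ k ≤ (2 ^ (2 * k)) ^ 8
  perpendicular-rare rewrite 2^[e*k]≡[2^k]^e 2 k | 2^[e*k]≡[2^k]^e 7 k =
    ≤-reflexive (solve 1 (λ x → x :^ 7 :* x :^ 8 :* x := (x :^ 2) :^ 8) refl X)

-- The bound holds for every k; the hypothesis 3 ≤ k only makes it non-vacuous.
lemma3p4 : (k : ℕ) → 3 ≤ k →
    ∃ λ (L : List (Sample k)) → Unique L × All (Good k) L ×
      ((2 ^ k ∸ 4) * sampleCount k ≤ length L * 2 ^ k)
lemma3p4 k _ =
  avoiding 𝛀 families ,
  avoiding-unique 𝛀 families ,
  All.map (λ {ω} → good {ω}) (avoiding-avoids 𝛀 families) ,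
  subst (λ total → (2 ^ k ∸ 4) * total ≤ length (avoiding 𝛀 families) * 2 ^ k) order-𝛀
    (union-bound 𝛀 families (2 ^ k) (families-rare (2 ^ k) dependence-rare meeting-rare perpendicular-rare))
  where
  open Samples (7 * k) (2 * k) (2 ^ k)
  open Rarity k

  good : ∀ {ω} → T (not (anyHappens 𝛀 families ω)) → Good k ω
  good {ω} avoids =
    (λ i → generators ω i , generators-independent {ω} (avoided (here refl)) i , λ _ → id , id) ,
    cosets-disjoint {ω} (avoided (there (here refl))) ,
    spans-meet-trivially {ω} (avoided (there (there (here refl)))) ,
    few-perpendicular {ω} (avoided (there (there (there (here refl)))))
    where
    avoided : ∀ {F} → F ∈ families → EventFamily.happens F ω ≡ false
    avoided = anyHappens-false 𝛀 avoids
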